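{- Let $\mathcal{D}(x;q)=\sum_{n\ge1}\big(\sum_{\ell=0}^{n-2} f_n(\ell,\ell)x^\ell\big)q^n$ and $\mathcal{F}(x,y;q)=\sum_{n\ge 1}\big(\sum_{\ell=0}^{n-1}\sum_{k=0}^{\ell} f_n(k,\ell)x^ky^\ell\big)q^n$. Then, as formal power series in $q$ (equivalently for $q$ in a sufficiently small neighborhood of $0$), $$\mathcal{D}(x;q)=\frac{1}{1-xq}\mathcal{D}(0;q)=\frac{q}{1-xq}\mathcal{F}(1,1;q).$$
   Context: An inversion sequence of length $n$ is a sequence $e=e_1\cdots e_n$ of integers with $0\le e_i\le i-1$. The reduction of a word replaces each occurrence of the $k$-th smallest distinct entry by $k-1$; $e$ contains a pattern $p$ if some subsequence (entries at increasing positions) has reduction $p$, and avoids $p$ otherwise. $\mathbf{I}_n(0012)$ is the set of inversion sequences of length $n$ avoiding $0012$. For $e\in\mathbf{I}_n(0012)$, $\mathcal{R}(e)$ is the set of values appearing at least twice in $e$, $\textsc{srpt}(e)=\min\mathcal{R}(e)$ with the convention $\textsc{srpt}(01\cdots(n-1))=n-1$, and $\textsc{last}(e)=e_n$. $f_n(k,\ell)$ is the number of $e\in\mathbf{I}_n(0012)$ with $\textsc{srpt}(e)=k$ and $\textsc{last}(e)=\ell$. Empty sums are $0$. -}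

module Defs where

open import Data.Bool using (Bool; true; false; _∧_; not; if_then_else_)
open import Data.Nat using (ℕ; zero; suc; _+_; _*_; _∸_; _⊓_; _≡ᵇ_; _<ᵇ_; _≤ᵇ_)
open import Data.List using (List; []; _∷_; _∷ʳ_; map; concatMap; upTo; length; filterᵇ)
open import Data.Nat.ListAction using (sum)
open import Data.Bool.ListAction using (any)

-- Inversion sequences are words (lists of naturals); the entry at position i
-- (1-indexed) satisfies 0 ≤ e_i ≤ i-1.

invSeqs : ℕ → List (List ℕ)
invSeqs zero    = [] ∷ []
invSeqs (suc n) = concatMap (λ e → map (λ v → e ∷ʳ v) (upTo (suc n))) (invSeqs n)

eqList : List ℕ → List ℕ → Bool
eqList []       []       = true
eqList (x ∷ xs) (y ∷ ys) = (x ≡ᵇ y) ∧ eqList xs ys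
eqList _        _        = false

dedup : List ℕ → List ℕ
dedup []       = []
dedup (x ∷ xs) = x ∷ filterᵇ (λ y → not (x ≡ᵇ y)) (dedup xs)

-- Reduction: replace each occurrence of the k-th smallest distinct entry by k-1,
-- i.e. each entry a by the number of distinct entries smaller than a.
reduce : List ℕ → List ℕ
reduce w = map (λ a → length (dedup (filterᵇ (λ b → b <ᵇ a) w))) w

subseqs : List ℕ → List (List ℕ)
subseqs []       = [] ∷ []
subseqs (x ∷ xs) = subseqs xs Data.List.++ map (x ∷_) (subseqs xs)

contains : List ℕ → List ℕ → Bool
contains p e = any (λ s → eqList (reduce s) p) (subseqs e)

avoids : List ℕ → List ℕ → Bool
avoids p e = not (contains p e)

p0012 : List ℕ
p0012 = 0 ∷ 0 ∷ 1 ∷ 2 ∷ []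

occ : ℕ → List ℕ → ℕ
occ v w = length (filterᵇ (λ a → a ≡ᵇ v) w)

-- R(e): the values appearing at least twice (as a list, possibly with repetitions).
repeated : List ℕ → List ℕ
repeated e = filterᵇ (λ a → 2 ≤ᵇ occ a e) e

minOr : ℕ → List ℕ → ℕ
minOr d []       = d
minOr d (x ∷ xs) = go x xs
  where
  go : ℕ → List ℕ → ℕ
  go m []       = m
  go m (y ∷ ys) = go (m ⊓ y) ys

-- srpt(e) = min R(e), with srpt = n-1 when R(e) is empty (e = 01⋯(n-1)).
srpt : List ℕ → ℕ
srpt e = minOr (length e ∸ 1) (repeated e)

-- last(e) = e_n (only used for n ≥ 1; the value on [] is irrelevant)
lastE : List ℕ → ℕ
lastE []           = 0
lastE (x ∷ [])     = x
lastE (_ ∷ y ∷ ys) = lastE (y ∷ ys)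

f : ℕ → ℕ → ℕ → ℕ
f n k ℓ = length (filterᵇ (λ e → avoids p0012 e ∧ (srpt e ≡ᵇ k) ∧ (lastE e ≡ᵇ ℓ)) (invSeqs n))

-- Formal power series in q whose coefficients are polynomials in x,
-- with natural-number coefficients: S n i = [q^n x^i] S.

Series : Set
Series = ℕ → ℕ → ℕ

sumTo : ℕ → (ℕ → ℕ) → ℕ
sumTo m g = sum (map g (upTo (suc m)))

_⊛_ : Series → Series → Series
(A ⊛ B) n i = sumTo n (λ a → sumTo i (λ b → A a b * B (n ∸ a) (i ∸ b)))

-- 1/(1 - x q) = Σ_j x^j q^j
geomXQ : Series
geomXQ n i = if n ≡ᵇ i then 1 else 0

qSer : Series
qSer n i = if (n ≡ᵇ 1) ∧ (i ≡ᵇ 0) then 1 else 0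

D : Series
D n ℓ = if (1 ≤ᵇ n) ∧ (ℓ + 2 ≤ᵇ n) then f n ℓ ℓ else 0

D0 : Series
D0 n i = if i ≡ᵇ 0 then D n 0 else 0

F11coef : ℕ → ℕ
F11coef zero    = 0
F11coef (suc m) = sumTo m (λ ℓ → sumTo ℓ (λ k → f (suc m) k ℓ))

F11 : Series
F11 n i = if i ≡ᵇ 0 then F11coef n else 0

-- An e ∈ I_n(0012) with srpt(e) ≥ 1 contains 0 only once, so it is 0 followed by e′ + 1 for an
-- inversion sequence e′; passing to e′ preserves 0012-avoidance and lowers srpt and last by one,
-- whence f_n(ℓ,ℓ) = f_{n-ℓ}(0,0) for n > ℓ.  For m ≥ 2 the sequences counted by f_m(0,0) are exactly the
-- 0012-avoiders of length m - 1 with a 0 appended, so f_m(0,0) = |I_{m-1}(0012)|.  Finally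
-- srpt(e) ≤ last(e) for every inversion sequence e, so [q^m] F(1,1;q) = |I_m(0012)|.
module Submission where

open import Defs
open import Algebra.Bundles using (CommutativeMonoid)
open import Data.Bool using (Bool; true; false; _∧_; _∨_; not; if_then_else_; T)
open import Data.Bool.Properties using (∧-zeroʳ; ∧-identityʳ; ∨-assoc; ∨-identityʳ; ∨-commutativeMonoid)
open import Data.Bool.ListAction using (any; or)
open import Data.Empty using (⊥-elim)
open import Data.List using (List; []; _∷_; _∷ʳ_; _++_; map; concatMap; upTo; length; filterᵇ)
open import Data.List.Membership.Propositional using (_∈_)
open import Data.List.Membership.Propositional.Properties using (∈-++⁺ˡ; ∈-++⁺ʳ; ∈-++⁻; ∈-filter⁺; ∈-filter⁻)
open import Data.List.Properties
  using ( ++-assoc; ++-identityʳ; length-++; length-map; map-++; map-∘; map-cong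
        ; map-upTo; map-applyUpTo; upTo-∷ʳ; filter-++; ∷ʳ-injectiveʳ)
open import Data.List.Relation.Unary.Any using (here; there)
open import Data.Nat
open import Data.Nat.ListAction using (sum)
open import Data.Nat.ListAction.Properties using (sum-++)
open import Data.Nat.Properties
open import Data.Product using (_×_; _,_; ∃; proj₁)
open import Data.Sum using (inj₁; inj₂)
open import Function using (_∘_)
open import Relation.Binary.PropositionalEquality
open import Relation.Nullary using (¬_; yes; no)
open import Relation.Nullary.Decidable using (dec-true; dec-false)

open import Algebra.Properties.CommutativeSemigroup +-commutativeSemigroup
  using () renaming (interchange to +-interchange)
open import Algebra.Properties.CommutativeSemigroup (CommutativeMonoid.commutativeSemigroup ∨-commutativeMonoid)
  using () renaming (interchange to ∨-interchange)

open ≡-Reasoning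

≡ᵇ-refl : ∀ n → (n ≡ᵇ n) ≡ true
≡ᵇ-refl n = dec-true (n ≟ n) refl

≢⇒≡ᵇ-false : ∀ {m n} → m ≢ n → (m ≡ᵇ n) ≡ false
≢⇒≡ᵇ-false {m} {n} = dec-false (m ≟ n)

≡ᵇ-true⇒≡ : ∀ {m n} → (m ≡ᵇ n) ≡ true → m ≡ n
≡ᵇ-true⇒≡ {m} {n} eq = ≡ᵇ⇒≡ m n (subst T (sym eq) _)

indicator : Bool → ℕ
indicator b = if b then 1 else 0

-- Finite sums Σ_{a ≤ m} g a

sumTo-∷ʳ : ∀ m g → sumTo (suc m) g ≡ sumTo m g + g (suc m)
sumTo-∷ʳ m g = begin
  sum (map g (upTo (suc (suc m))))              ≡⟨ cong (sum ∘ map g) (sym (upTo-∷ʳ (suc m))) ⟩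
  sum (map g (upTo (suc m) ∷ʳ suc m))           ≡⟨ cong sum (map-++ g (upTo (suc m)) (suc m ∷ [])) ⟩
  sum (map g (upTo (suc m)) ++ g (suc m) ∷ [])  ≡⟨ sum-++ (map g (upTo (suc m))) (g (suc m) ∷ []) ⟩
  sumTo m g + (g (suc m) + 0)                   ≡⟨ cong (sumTo m g +_) (+-identityʳ (g (suc m))) ⟩
  sumTo m g + g (suc m)                         ∎

sumTo-suc : ∀ m g → sumTo (suc m) g ≡ g 0 + sumTo m (g ∘ suc)
sumTo-suc m g = cong (g 0 +_) (trans (cong sum (map-applyUpTo suc g (suc m))) (sym (cong sum (map-upTo (g ∘ suc) (suc m)))))

sumTo-cong : ∀ m {g h : ℕ → ℕ} → (∀ a → a ≤ m → g a ≡ h a) → sumTo m g ≡ sumTo m h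
sumTo-cong zero    eq = cong (_+ 0) (eq 0 z≤n)
sumTo-cong (suc m) {g} {h} eq = begin
  sumTo (suc m) g        ≡⟨ sumTo-∷ʳ m g ⟩
  sumTo m g + g (suc m)  ≡⟨ cong₂ _+_ (sumTo-cong m (λ a a≤m → eq a (m≤n⇒m≤1+n a≤m))) (eq (suc m) ≤-refl) ⟩
  sumTo m h + h (suc m)  ≡⟨ sumTo-∷ʳ m h ⟨
  sumTo (suc m) h        ∎

sumTo-zero : ∀ m {g : ℕ → ℕ} → (∀ a → a ≤ m → g a ≡ 0) → sumTo m g ≡ 0
sumTo-zero zero    eq = cong (_+ 0) (eq 0 z≤n)
sumTo-zero (suc m) {g} eq = begin
  sumTo (suc m) g        ≡⟨ sumTo-∷ʳ m g ⟩
  sumTo m g + g (suc m)  ≡⟨ cong₂ _+_ (sumTo-zero m (λ a a≤m → eq a (m≤n⇒m≤1+n a≤m))) (eq (suc m) ≤-refl) ⟩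
  0                      ∎

sumTo-single : ∀ m c {g : ℕ → ℕ} → c ≤ m → (∀ a → a ≤ m → a ≢ c → g a ≡ 0) → sumTo m g ≡ g c
sumTo-single zero .zero {g} z≤n _ = +-identityʳ (g 0)
sumTo-single (suc m) c {g} c≤1+m eq with c ≟ suc m
... | yes refl = begin
  sumTo (suc m) g
    ≡⟨ sumTo-∷ʳ m g ⟩
  sumTo m g + g (suc m)
    ≡⟨ cong (_+ g (suc m)) (sumTo-zero m (λ a a≤m → eq a (m≤n⇒m≤1+n a≤m) (<⇒≢ (s≤s a≤m)))) ⟩
  g (suc m) ∎
... | no c≢1+m = begin
  sumTo (suc m) g
    ≡⟨ sumTo-∷ʳ m g ⟩
  sumTo m g + g (suc m)
    ≡⟨ cong₂ _+_ (sumTo-single m c c≤m (λ a a≤m → eq a (m≤n⇒m≤1+n a≤m))) (eq (suc m) ≤-refl (c≢1+m ∘ sym)) ⟩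
  g c + 0
    ≡⟨ +-identityʳ (g c) ⟩
  g c ∎
  where
  c≤m : c ≤ m
  c≤m = s≤s⁻¹ (≤∧≢⇒< c≤1+m c≢1+m)

sumTo-+ : ∀ m (g h : ℕ → ℕ) → sumTo m (λ a → g a + h a) ≡ sumTo m g + sumTo m h
sumTo-+ zero    g h = begin
  g 0 + h 0 + 0        ≡⟨ +-identityʳ (g 0 + h 0) ⟩
  g 0 + h 0            ≡⟨ cong₂ _+_ (+-identityʳ (g 0)) (+-identityʳ (h 0)) ⟨
  g 0 + 0 + (h 0 + 0)  ∎
sumTo-+ (suc m) g h = begin
  sumTo (suc m) (λ a → g a + h a)
    ≡⟨ sumTo-∷ʳ m (λ a → g a + h a) ⟩
  sumTo m (λ a → g a + h a) + (g (suc m) + h (suc m))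
    ≡⟨ cong (_+ (g (suc m) + h (suc m))) (sumTo-+ m g h) ⟩
  sumTo m g + sumTo m h + (g (suc m) + h (suc m))
    ≡⟨ +-interchange (sumTo m g) (sumTo m h) (g (suc m)) (h (suc m)) ⟩
  sumTo m g + g (suc m) + (sumTo m h + h (suc m))
    ≡⟨ cong₂ _+_ (sumTo-∷ʳ m g) (sumTo-∷ʳ m h) ⟨
  sumTo (suc m) g + sumTo (suc m) h ∎

sumTo-comm : ∀ m n (X : ℕ → ℕ → ℕ) → sumTo m (λ a → sumTo n (X a)) ≡ sumTo n (λ b → sumTo m (λ a → X a b))
sumTo-comm zero    n X = begin
  sumTo n (X 0) + 0              ≡⟨ +-identityʳ (sumTo n (X 0)) ⟩
  sumTo n (X 0)                  ≡⟨ sumTo-cong n (λ b _ → +-identityʳ (X 0 b)) ⟨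
  sumTo n (λ b → X 0 b + 0)      ∎
sumTo-comm (suc m) n X = begin
  sumTo (suc m) (λ a → sumTo n (X a))
    ≡⟨ sumTo-∷ʳ m (λ a → sumTo n (X a)) ⟩
  sumTo m (λ a → sumTo n (X a)) + sumTo n (X (suc m))
    ≡⟨ cong (_+ sumTo n (X (suc m))) (sumTo-comm m n X) ⟩
  sumTo n (λ b → sumTo m (λ a → X a b)) + sumTo n (X (suc m))
    ≡⟨ sumTo-+ n (λ b → sumTo m (λ a → X a b)) (X (suc m)) ⟨
  sumTo n (λ b → sumTo m (λ a → X a b) + X (suc m) b)
    ≡⟨ sumTo-cong n (λ b _ → sumTo-∷ʳ m (λ a → X a b)) ⟨
  sumTo n (λ b → sumTo (suc m) (λ a → X a b)) ∎

sumTo-indicator : ∀ n c (g : ℕ → ℕ) → c ≤ n → sumTo n (λ a → if a ≡ᵇ c then g a else 0) ≡ g c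
sumTo-indicator n c g c≤n = begin
  sumTo n (λ a → if a ≡ᵇ c then g a else 0)
    ≡⟨ sumTo-single n c c≤n (λ a _ a≢c → cong (if_then g a else 0) (≢⇒≡ᵇ-false a≢c)) ⟩
  (if c ≡ᵇ c then g c else 0)
    ≡⟨ cong (if_then g c else 0) (≡ᵇ-refl c) ⟩
  g c ∎

sumTo-indicator-> : ∀ n c (g : ℕ → ℕ) → n < c → sumTo n (λ a → if a ≡ᵇ c then g a else 0) ≡ 0
sumTo-indicator-> n c g n<c =
  sumTo-zero n (λ a a≤n → cong (if_then g a else 0) (≢⇒≡ᵇ-false (<⇒≢ (≤-<-trans a≤n n<c))))

-- q^s / (1 - x q)
geomShift : ℕ → Series
geomShift s a b = if a ≡ᵇ s + b then 1 else 0

ConstantInX : Series → Set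
ConstantInX A = ∀ n i → i ≢ 0 → A n i ≡ 0

⊛-congˡ : ∀ {A A′} B → (∀ a b → A a b ≡ A′ a b) → ∀ n i → (A ⊛ B) n i ≡ (A′ ⊛ B) n i
⊛-congˡ B eq n i = sumTo-cong n (λ a _ → sumTo-cong i (λ b _ → cong (_* B (n ∸ a) (i ∸ b)) (eq a b)))

geomShift-⊛-column : ∀ {A} → ConstantInX A → ∀ s n i a →
  sumTo i (λ b → geomShift s a b * A (n ∸ a) (i ∸ b)) ≡ (if a ≡ᵇ s + i then A (n ∸ a) 0 else 0)
geomShift-⊛-column {A} const s n i a = begin
  sumTo i (λ b → geomShift s a b * A (n ∸ a) (i ∸ b))  ≡⟨ sumTo-single i i ≤-refl off-diagonal ⟩
  geomShift s a i * A (n ∸ a) (i ∸ i)                  ≡⟨ cong (λ j → geomShift s a i * A (n ∸ a) j) (n∸n≡0 i) ⟩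
  geomShift s a i * A (n ∸ a) 0                        ≡⟨ indicator-* (a ≡ᵇ s + i) ⟩
  (if a ≡ᵇ s + i then A (n ∸ a) 0 else 0)              ∎
  where
  off-diagonal : ∀ b → b ≤ i → b ≢ i → geomShift s a b * A (n ∸ a) (i ∸ b) ≡ 0
  off-diagonal b b≤i b≢i =
    trans (cong (geomShift s a b *_) (const (n ∸ a) (i ∸ b) (b≢i ∘ ≤-antisym b≤i ∘ m∸n≡0⇒m≤n)))
          (*-zeroʳ (geomShift s a b))
  indicator-* : ∀ c → indicator c * A (n ∸ a) 0 ≡ (if c then A (n ∸ a) 0 else 0)
  indicator-* true  = +-identityʳ _
  indicator-* false = refl

geomShift-⊛ : ∀ {A} → ConstantInX A → ∀ s {n i} → s + i ≤ n → (geomShift s ⊛ A) n i ≡ A (n ∸ (s + i)) 0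
geomShift-⊛ {A} const s {n} {i} s+i≤n = begin
  (geomShift s ⊛ A) n i                                 ≡⟨ sumTo-cong n (λ a _ → geomShift-⊛-column const s n i a) ⟩
  sumTo n (λ a → if a ≡ᵇ s + i then A (n ∸ a) 0 else 0)  ≡⟨ sumTo-indicator n (s + i) (λ a → A (n ∸ a) 0) s+i≤n ⟩
  A (n ∸ (s + i)) 0                                     ∎

geomShift-⊛-> : ∀ {A} → ConstantInX A → ∀ s {n i} → n < s + i → (geomShift s ⊛ A) n i ≡ 0
geomShift-⊛-> {A} const s {n} {i} n<s+i = begin
  (geomShift s ⊛ A) n i                                 ≡⟨ sumTo-cong n (λ a _ → geomShift-⊛-column const s n i a) ⟩
  sumTo n (λ a → if a ≡ᵇ s + i then A (n ∸ a) 0 else 0)  ≡⟨ sumTo-indicator-> n (s + i) (λ a → A (n ∸ a) 0) n<s+i ⟩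
  0                                                     ∎

qSer-⊛-column : ∀ (B : Series) c n b → c ≢ 1 → sumTo b (λ d → qSer c d * B n (b ∸ d)) ≡ 0
qSer-⊛-column B c n b c≢1 =
  sumTo-zero b (λ d _ → cong (λ t → indicator (t ∧ (d ≡ᵇ 0)) * B n (b ∸ d)) (≢⇒≡ᵇ-false c≢1))

qSer-⊛-suc : ∀ (B : Series) a b → (qSer ⊛ B) (suc a) b ≡ B a b
qSer-⊛-suc B a b = begin
  (qSer ⊛ B) (suc a) b
    ≡⟨ sumTo-single (suc a) 1 (s≤s z≤n) (λ c _ → qSer-⊛-column B c (suc a ∸ c) b) ⟩
  sumTo b (λ d → qSer 1 d * B a (b ∸ d))
    ≡⟨ sumTo-single b 0 z≤n (λ d _ d≢0 → cong (λ t → indicator t * B a (b ∸ d)) (≢⇒≡ᵇ-false d≢0)) ⟩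
  B a b + 0
    ≡⟨ +-identityʳ (B a b) ⟩
  B a b ∎

qSer-⊛-geomXQ : ∀ a b → (qSer ⊛ geomXQ) a b ≡ geomShift 1 a b
qSer-⊛-geomXQ zero    b = trans (+-identityʳ _) (qSer-⊛-column geomXQ 0 0 b (λ ()))
qSer-⊛-geomXQ (suc a) b = qSer-⊛-suc geomXQ a b

D0-constantInX : ConstantInX D0
D0-constantInX n i i≢0 = cong (if_then D n 0 else 0) (≢⇒≡ᵇ-false i≢0)

F11-constantInX : ConstantInX F11
F11-constantInX n i i≢0 = cong (if_then F11coef n else 0) (≢⇒≡ᵇ-false i≢0)

-- Sums over inversion sequences

data InvSeq : List ℕ → Set where
  []   : InvSeq []
  snoc : ∀ {p v} → InvSeq p → v ≤ length p → InvSeq (p ∷ʳ v)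

length-∷ʳ : ∀ (p : List ℕ) v → length (p ∷ʳ v) ≡ suc (length p)
length-∷ʳ []      v = refl
length-∷ʳ (x ∷ p) v = cong suc (length-∷ʳ p v)

-- The sum of h over the m-entry extensions of a prefix p, where k is the length of p.
sumExt : (List ℕ → ℕ) → ℕ → List ℕ → ℕ → ℕ
sumExt h k p zero    = h p
sumExt h k p (suc m) = sumTo k (λ v → sumExt h (suc k) (p ∷ʳ v) m)

sumExt-cong : ∀ m {h h′ : List ℕ → ℕ} → (∀ q → h q ≡ h′ q) → ∀ k p → sumExt h k p m ≡ sumExt h′ k p m
sumExt-cong zero    eq k p = eq p
sumExt-cong (suc m) eq k p = sumTo-cong k (λ v _ → sumExt-cong m eq (suc k) (p ∷ʳ v))

sumExt-congInv : ∀ m {h h′ : List ℕ → ℕ} k p → InvSeq p → length p ≡ k →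
  (∀ e → InvSeq e → length e ≡ k + m → h e ≡ h′ e) → sumExt h k p m ≡ sumExt h′ k p m
sumExt-congInv zero    k p inv len eq = eq p inv (trans len (sym (+-identityʳ k)))
sumExt-congInv (suc m) k p inv len eq = sumTo-cong k λ v v≤k →
  sumExt-congInv m (suc k) (p ∷ʳ v) (snoc inv (subst (v ≤_) (sym len) v≤k)) (trans (length-∷ʳ p v) (cong suc len))
    (λ e inv-e len-e → eq e inv-e (trans len-e (sym (+-suc k m))))

sumExt-∷ʳ : ∀ m h k p → sumExt h k p (suc m) ≡ sumExt (λ q → sumTo (k + m) (λ v → h (q ∷ʳ v))) k p m
sumExt-∷ʳ zero    h k p = cong (λ j → sumTo j (λ v → h (p ∷ʳ v))) (sym (+-identityʳ k))
sumExt-∷ʳ (suc m) h k p = sumTo-cong k λ v _ → begin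
  sumExt h (suc k) (p ∷ʳ v) (suc m)
    ≡⟨ sumExt-∷ʳ m h (suc k) (p ∷ʳ v) ⟩
  sumExt (λ q → sumTo (suc k + m) (λ w → h (q ∷ʳ w))) (suc k) (p ∷ʳ v) m
    ≡⟨ sumExt-cong m (λ q → cong (λ j → sumTo j (λ w → h (q ∷ʳ w))) (sym (+-suc k m))) (suc k) (p ∷ʳ v) ⟩
  sumExt (λ q → sumTo (k + suc m) (λ w → h (q ∷ʳ w))) (suc k) (p ∷ʳ v) m ∎

sumExt-++ : ∀ m h k p → sumExt h k p m ≡ sumExt (h ∘ (p ++_)) k [] m
sumExt-++ zero    h k p = cong h (sym (++-identityʳ p))
sumExt-++ (suc m) h k p = sumTo-cong k λ v _ → begin
  sumExt h (suc k) (p ∷ʳ v) m                      ≡⟨ sumExt-++ m h (suc k) (p ∷ʳ v) ⟩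
  sumExt (h ∘ ((p ∷ʳ v) ++_)) (suc k) [] m          ≡⟨ sumExt-cong m (λ q → cong h (++-assoc p (v ∷ []) q)) (suc k) [] ⟩
  sumExt (h ∘ (p ++_) ∘ (v ∷_)) (suc k) [] m        ≡⟨ sumExt-++ m (h ∘ (p ++_)) (suc k) (v ∷ []) ⟨
  sumExt (h ∘ (p ++_)) (suc k) (v ∷ []) m          ∎

-- Every inversion sequence starts with 0.
sumExt-head : ∀ m h → sumExt h 0 [] (suc m) ≡ sumExt (h ∘ (0 ∷_)) 1 [] m
sumExt-head m h = trans (+-identityʳ _) (sumExt-++ m h 1 (0 ∷ []))

sumExt-≡0 : ∀ m h k p → (∀ r → h (p ++ r) ≡ 0) → sumExt h k p m ≡ 0
sumExt-≡0 zero    h k p eq = trans (cong h (sym (++-identityʳ p))) (eq [])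
sumExt-≡0 (suc m) h k p eq = sumTo-zero k λ v _ →
  sumExt-≡0 m h (suc k) (p ∷ʳ v) (λ r → trans (cong h (++-assoc p (v ∷ []) r)) (eq (v ∷ r)))

sumExt-sumTo : ∀ m a (G : ℕ → List ℕ → ℕ) k p →
  sumExt (λ e → sumTo a (λ i → G i e)) k p m ≡ sumTo a (λ i → sumExt (G i) k p m)
sumExt-sumTo zero    a G k p = refl
sumExt-sumTo (suc m) a G k p =
  trans (sumTo-cong k (λ v _ → sumExt-sumTo m a G (suc k) (p ∷ʳ v)))
        (sumTo-comm k a (λ v i → sumExt (G i) (suc k) (p ∷ʳ v) m))

-- If g vanishes on words containing 0, only positive entries contribute, and these are shifts.
sumExt-map-suc : ∀ m (g : List ℕ → ℕ) → (∀ q → 0 ∈ q → g q ≡ 0) → ∀ k p →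
  sumExt g (suc k) (map suc p) m ≡ sumExt (g ∘ map suc) k p m
sumExt-map-suc zero    g g0 k p = refl
sumExt-map-suc (suc m) g g0 k p = begin
  sumTo (suc k) (λ v → sumExt g (suc (suc k)) (map suc p ∷ʳ v) m)
    ≡⟨ sumTo-suc k (λ v → sumExt g (suc (suc k)) (map suc p ∷ʳ v) m) ⟩
  sumExt g (suc (suc k)) (map suc p ∷ʳ 0) m
    + sumTo k (λ v → sumExt g (suc (suc k)) (map suc p ∷ʳ suc v) m)
      ≡⟨ cong₂ _+_ entry-0 (sumTo-cong k λ v _ → shifted v) ⟩
  0 + sumTo k (λ v → sumExt (g ∘ map suc) (suc k) (p ∷ʳ v) m) ∎
  where
  entry-0 : sumExt g (suc (suc k)) (map suc p ∷ʳ 0) m ≡ 0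
  entry-0 = sumExt-≡0 m g _ _ λ r →
    g0 _ (subst (0 ∈_) (sym (++-assoc (map suc p) (0 ∷ []) r)) (∈-++⁺ʳ (map suc p) (here refl)))
  shifted : ∀ v → sumExt g (suc (suc k)) (map suc p ∷ʳ suc v) m ≡ sumExt (g ∘ map suc) (suc k) (p ∷ʳ v) m
  shifted v = trans (cong (λ q → sumExt g (suc (suc k)) q m) (sym (map-++ suc p (v ∷ []))))
                    (sumExt-map-suc m g g0 (suc k) (p ∷ʳ v))

sum-concatMap : ∀ h (F : List ℕ → List (List ℕ)) L → sum (map h (concatMap F L)) ≡ sum (map (sum ∘ map h ∘ F) L)
sum-concatMap h F []      = refl
sum-concatMap h F (x ∷ L) = begin
  sum (map h (F x ++ concatMap F L))              ≡⟨ cong sum (map-++ h (F x) (concatMap F L)) ⟩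
  sum (map h (F x) ++ map h (concatMap F L))      ≡⟨ sum-++ (map h (F x)) _ ⟩
  sum (map h (F x)) + sum (map h (concatMap F L)) ≡⟨ cong (sum (map h (F x)) +_) (sum-concatMap h F L) ⟩
  sum (map (sum ∘ map h ∘ F) (x ∷ L))             ∎

sum-invSeqs : ∀ n h → sum (map h (invSeqs n)) ≡ sumExt h 0 [] n
sum-invSeqs zero    h = +-identityʳ (h [])
sum-invSeqs (suc n) h = begin
  sum (map h (invSeqs (suc n)))
    ≡⟨ sum-concatMap h _ (invSeqs n) ⟩
  sum (map (λ e → sum (map h (map (e ∷ʳ_) (upTo (suc n))))) (invSeqs n))
    ≡⟨ cong sum (map-cong (λ e → cong sum (map-∘ (upTo (suc n)))) (invSeqs n)) ⟨
  sum (map (λ e → sumTo n (λ v → h (e ∷ʳ v))) (invSeqs n))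
    ≡⟨ sum-invSeqs n _ ⟩
  sumExt (λ e → sumTo n (λ v → h (e ∷ʳ v))) 0 [] n
    ≡⟨ sumExt-∷ʳ n h 0 [] ⟨
  sumExt h 0 [] (suc n) ∎

length-filterᵇ : ∀ Q (L : List (List ℕ)) → length (filterᵇ Q L) ≡ sum (map (indicator ∘ Q) L)
length-filterᵇ Q []      = refl
length-filterᵇ Q (x ∷ L) with Q x
... | true  = cong suc (length-filterᵇ Q L)
... | false = length-filterᵇ Q L

count-invSeqs : ∀ n Q → length (filterᵇ Q (invSeqs n)) ≡ sumExt (indicator ∘ Q) 0 [] n
count-invSeqs n Q = trans (length-filterᵇ Q (invSeqs n)) (sum-invSeqs n (indicator ∘ Q))

lastE-∷ʳ : ∀ (p : List ℕ) v → lastE (p ∷ʳ v) ≡ v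
lastE-∷ʳ []          v = refl
lastE-∷ʳ (x ∷ [])     v = refl
lastE-∷ʳ (x ∷ y ∷ p) v = lastE-∷ʳ (y ∷ p) v

lastE-map-suc : ∀ x r → lastE (map suc (x ∷ r)) ≡ suc (lastE (x ∷ r))
lastE-map-suc x []      = refl
lastE-map-suc x (y ∷ r) = lastE-map-suc y r

occ-++ : ∀ y xs ys → occ y (xs ++ ys) ≡ occ y xs + occ y ys
occ-++ y xs ys = trans (cong length (filter-++ _ xs ys)) (length-++ (filterᵇ (_≡ᵇ y) xs))

occ-∷-self : ∀ y L → occ y (y ∷ L) ≡ suc (occ y L)
occ-∷-self y L rewrite ≡ᵇ-refl y = refl

occ-∷ : ∀ y x L → occ y L ≤ occ y (x ∷ L)
occ-∷ y x L with x ≡ᵇ y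
... | true  = n≤1+n _
... | false = ≤-refl

∈⇒1≤occ : ∀ {y L} → y ∈ L → 1 ≤ occ y L
∈⇒1≤occ {y} {.y ∷ L} (here refl) = subst (1 ≤_) (sym (occ-∷-self y L)) (s≤s z≤n)
∈⇒1≤occ {y} {x ∷ L}  (there y∈L) = ≤-trans (∈⇒1≤occ y∈L) (occ-∷ y x L)

occ-∷ʳ : ∀ y p v → occ y p ≤ occ y (p ∷ʳ v)
occ-∷ʳ y p v = subst (occ y p ≤_) (sym (occ-++ y p (v ∷ []))) (m≤m+n (occ y p) _)

∈⇒2≤occ-∷ʳ : ∀ {v p} → v ∈ p → 2 ≤ occ v (p ∷ʳ v)
∈⇒2≤occ-∷ʳ {v} {p} v∈p = subst (2 ≤_) (sym (trans (occ-++ v p (v ∷ [])) (cong (occ v p +_) (occ-∷-self v []))))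
  (subst (2 ≤_) (+-comm 1 (occ v p)) (s≤s (∈⇒1≤occ v∈p)))

occ-0-map-suc : ∀ r → occ 0 (map suc r) ≡ 0
occ-0-map-suc []      = refl
occ-0-map-suc (x ∷ r) = occ-0-map-suc r

occ-suc-map-suc : ∀ b r → occ (suc b) (map suc r) ≡ occ b r
occ-suc-map-suc b []      = refl
occ-suc-map-suc b (x ∷ r) with x ≡ᵇ b
... | true  = cong suc (occ-suc-map-suc b r)
... | false = occ-suc-map-suc b r

minOr-∷-≤-head : ∀ d x ys → minOr d (x ∷ ys) ≤ x
minOr-∷-≤-head d x []       = ≤-refl
minOr-∷-≤-head d x (z ∷ zs) = ≤-trans (minOr-∷-≤-head d (x ⊓ z) zs) (m⊓n≤m x z)

minOr-∷-≤ : ∀ d x ys {y} → y ∈ x ∷ ys → minOr d (x ∷ ys) ≤ y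
minOr-∷-≤ d x ys       (here refl)         = minOr-∷-≤-head d x ys
minOr-∷-≤ d x (z ∷ zs) (there (here refl)) = ≤-trans (minOr-∷-≤-head d (x ⊓ z) zs) (m⊓n≤n x z)
minOr-∷-≤ d x (z ∷ zs) (there (there y∈))  = minOr-∷-≤ d (x ⊓ z) zs (there y∈)

minOr-≤ : ∀ d {y} L → y ∈ L → minOr d L ≤ y
minOr-≤ d (x ∷ ys) = minOr-∷-≤ d x ys

minOr-≤-default : ∀ d L → (∀ y → y ∈ L → y ≤ d) → minOr d L ≤ d
minOr-≤-default d []       bound = ≤-refl
minOr-≤-default d (x ∷ ys) bound = ≤-trans (minOr-∷-≤-head d x ys) (bound x (here refl))

minOr-map-suc : ∀ d L → minOr (suc d) (map suc L) ≡ suc (minOr d L)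
minOr-map-suc d []      = refl
minOr-map-suc d (x ∷ L) = go x L
  where
  go : ∀ x L → minOr (suc d) (suc x ∷ map suc L) ≡ suc (minOr d (x ∷ L))
  go x []      = refl
  go x (y ∷ L) = go (x ⊓ y) L

srpt-≤ : ∀ {y} e → y ∈ e → 2 ≤ occ y e → srpt e ≤ y
srpt-≤ e y∈e 2≤occ = minOr-≤ (length e ∸ 1) (repeated e) (∈-filter⁺ _ y∈e (≤⇒≤ᵇ 2≤occ))

srpt-≤-default : ∀ e → (∀ y → y ∈ e → y ≤ length e ∸ 1) → srpt e ≤ length e ∸ 1
srpt-≤-default e bound = minOr-≤-default (length e ∸ 1) (repeated e) (λ y y∈ → bound y (proj₁ (∈-filter⁻ _ y∈)))

srpt-0∷ : ∀ q → 0 ∈ q → srpt (0 ∷ q) ≡ 0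
srpt-0∷ q 0∈q =
  n≤0⇒n≡0 (srpt-≤ (0 ∷ q) (here refl) (subst (2 ≤_) (sym (occ-∷-self 0 q)) (s≤s (∈⇒1≤occ 0∈q))))

repeated-0∷map-suc : ∀ r → repeated (0 ∷ map suc r) ≡ map suc (repeated r)
repeated-0∷map-suc r rewrite occ-0-map-suc r = go r
  where
  go : ∀ s → filterᵇ (λ a → 2 ≤ᵇ occ a (0 ∷ map suc r)) (map suc s)
             ≡ map suc (filterᵇ (λ a → 2 ≤ᵇ occ a r) s)
  go []      = refl
  go (x ∷ s) rewrite occ-suc-map-suc x r with 2 ≤ᵇ occ x r
  ... | true  = cong (suc x ∷_) (go s)
  ... | false = go s

srpt-0∷map-suc : ∀ x r → srpt (0 ∷ map suc (x ∷ r)) ≡ suc (srpt (x ∷ r))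
srpt-0∷map-suc x r rewrite repeated-0∷map-suc (x ∷ r) | length-map suc r = minOr-map-suc (length r) (repeated (x ∷ r))

data Shape (p : List ℕ) : Set where
  full    : (∀ y → y < length p → y ∈ p) → Shape p
  repeats : ∀ x → 2 ≤ occ x p → (∀ y → y ≤ x → y ∈ p) → Shape p

InvSeq-< : ∀ {p y} → InvSeq p → y ∈ p → y < length p
InvSeq-< {y = y} (snoc {p} {v} inv v≤) y∈ with ∈-++⁻ p y∈
... | inj₁ y∈p         = subst (y <_) (sym (length-∷ʳ p v)) (m≤n⇒m≤1+n (InvSeq-< inv y∈p))
... | inj₂ (here refl) = subst (y <_) (sym (length-∷ʳ p v)) (s≤s v≤)

shape : ∀ {p} → InvSeq p → Shape p
shape [] = full (λ _ ())
shape (snoc {p} {v} inv v≤) with shape inv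
... | repeats x 2≤occ below = repeats x (≤-trans 2≤occ (occ-∷ʳ x p v)) (λ y y≤x → ∈-++⁺ˡ (below y y≤x))
... | full all-below with v <? length p
...   | yes v<len =
  repeats v (∈⇒2≤occ-∷ʳ (all-below v v<len)) (λ y y≤v → ∈-++⁺ˡ (all-below y (≤-<-trans y≤v v<len)))
...   | no  v≮len = full λ y y<len → case-last y (subst (y <_) (length-∷ʳ p v) y<len)
  where
  case-last : ∀ y → y < suc (length p) → y ∈ p ∷ʳ v
  case-last y y<1+len with y <? length p
  ... | yes y<len = ∈-++⁺ˡ (all-below y y<len)
  ... | no  y≮len =
    ∈-++⁺ʳ p (here (trans (≤-antisym (s≤s⁻¹ y<1+len) (≮⇒≥ y≮len)) (sym (≤-antisym v≤ (≮⇒≥ v≮len)))))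

srpt-≤-length : ∀ {e} → InvSeq e → srpt e ≤ length e ∸ 1
srpt-≤-length {e} inv = srpt-≤-default e (λ y y∈e → <⇒≤pred (InvSeq-< inv y∈e))

srpt-∷ʳ-∈ : ∀ {p v} → v ∈ p → srpt (p ∷ʳ v) ≤ v
srpt-∷ʳ-∈ {p} v∈p = srpt-≤ (p ∷ʳ _) (∈-++⁺ʳ p (here refl)) (∈⇒2≤occ-∷ʳ v∈p)

-- The new entry v is repeated, or lies above a repeated value, or equals |p| and bounds every entry.
srpt-∷ʳ-≤ : ∀ {p v} → InvSeq p → v ≤ length p → srpt (p ∷ʳ v) ≤ v
srpt-∷ʳ-≤ {p} {v} inv v≤ with shape inv
... | repeats x 2≤occ below with x ≤? v
...   | yes x≤v = ≤-trans (srpt-≤ (p ∷ʳ v) (∈-++⁺ˡ (below x ≤-refl)) (≤-trans 2≤occ (occ-∷ʳ x p v))) x≤v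
...   | no  x≰v = srpt-∷ʳ-∈ (below v (<⇒≤ (≰⇒> x≰v)))
srpt-∷ʳ-≤ {p} {v} inv v≤ | full all-below with v <? length p
...   | yes v<len = srpt-∷ʳ-∈ (all-below v v<len)
...   | no  v≮len =
  ≤-trans (srpt-≤-length (snoc inv v≤)) (subst (λ n → n ∸ 1 ≤ v) (sym (length-∷ʳ p v)) (≮⇒≥ v≮len))

-- Avoidance of 0012

any-++ : ∀ (Q : List ℕ → Bool) xs ys → any Q (xs ++ ys) ≡ any Q xs ∨ any Q ys
any-++ Q []       ys = refl
any-++ Q (x ∷ xs) ys = trans (cong (Q x ∨_) (any-++ Q xs ys)) (sym (∨-assoc (Q x) (any Q xs) (any Q ys)))

any-map : ∀ (Q : List ℕ → Bool) (g : List ℕ → List ℕ) xs → any Q (map g xs) ≡ any (Q ∘ g) xs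
any-map Q g xs = cong or (sym (map-∘ xs))

any-cong : ∀ {Q Q′ : List ℕ → Bool} xs → (∀ s → Q s ≡ Q′ s) → any Q xs ≡ any Q′ xs
any-cong []       eq = refl
any-cong (x ∷ xs) eq = cong₂ _∨_ (eq x) (any-cong xs eq)

any-false : ∀ {Q : List ℕ → Bool} xs → (∀ s → Q s ≡ false) → any Q xs ≡ false
any-false []       eq = refl
any-false (x ∷ xs) eq rewrite eq x = any-false xs eq

any-subseqs-∷ : ∀ Q y e → any Q (subseqs (y ∷ e)) ≡ any Q (subseqs e) ∨ any (Q ∘ (y ∷_)) (subseqs e)
any-subseqs-∷ Q y e = trans (any-++ Q (subseqs e) _) (cong (any Q (subseqs e) ∨_) (any-map Q (y ∷_) (subseqs e)))

any-subseqs-∷ʳ : ∀ Q e x → any Q (subseqs (e ∷ʳ x)) ≡ any Q (subseqs e) ∨ any (Q ∘ (_∷ʳ x)) (subseqs e)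
any-subseqs-∷ʳ Q []      x = cong (_∨ (Q (x ∷ []) ∨ false)) (sym (∨-identityʳ (Q [])))
any-subseqs-∷ʳ Q (y ∷ e) x = begin
  any Q (subseqs (y ∷ e ∷ʳ x))
    ≡⟨ any-subseqs-∷ Q y (e ∷ʳ x) ⟩
  any Q (subseqs (e ∷ʳ x)) ∨ any (Q ∘ (y ∷_)) (subseqs (e ∷ʳ x))
    ≡⟨ cong₂ _∨_ (any-subseqs-∷ʳ Q e x) (any-subseqs-∷ʳ (Q ∘ (y ∷_)) e x) ⟩
  (a ∨ b) ∨ (c ∨ d)
    ≡⟨ ∨-interchange a b c d ⟩
  (a ∨ c) ∨ (b ∨ d)
    ≡⟨ cong₂ _∨_ (any-subseqs-∷ Q y e) (any-subseqs-∷ (Q ∘ (_∷ʳ x)) y e) ⟨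
  any Q (subseqs (y ∷ e)) ∨ any (Q ∘ (_∷ʳ x)) (subseqs (y ∷ e)) ∎
  where
  a b c d : Bool
  a = any Q (subseqs e)
  b = any (Q ∘ (_∷ʳ x)) (subseqs e)
  c = any (Q ∘ (y ∷_)) (subseqs e)
  d = any (Q ∘ (y ∷_) ∘ (_∷ʳ x)) (subseqs e)

subseqs-map : ∀ (g : ℕ → ℕ) e → subseqs (map g e) ≡ map (map g) (subseqs e)
subseqs-map g []      = refl
subseqs-map g (x ∷ e) = begin
  subseqs (map g e) ++ map (g x ∷_) (subseqs (map g e))  ≡⟨ cong (λ S → S ++ map (g x ∷_) S) (subseqs-map g e) ⟩
  S′ ++ map (g x ∷_) S′                                  ≡⟨ cong (S′ ++_) (trans (sym (map-∘ S)) (map-∘ S)) ⟩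
  S′ ++ map (map g) (map (x ∷_) S)                       ≡⟨ map-++ (map g) S (map (x ∷_) S) ⟨
  map (map g) (S ++ map (x ∷_) S)                        ∎
  where
  S S′ : List (List ℕ)
  S  = subseqs e
  S′ = map (map g) S

filterᵇ-map : ∀ (P : ℕ → Bool) (g : ℕ → ℕ) xs → filterᵇ P (map g xs) ≡ map g (filterᵇ (P ∘ g) xs)
filterᵇ-map P g []       = refl
filterᵇ-map P g (x ∷ xs) with P (g x)
... | true  = cong (g x ∷_) (filterᵇ-map P g xs)
... | false = filterᵇ-map P g xs

dedup-map-suc : ∀ L → dedup (map suc L) ≡ map suc (dedup L)
dedup-map-suc []      = refl
dedup-map-suc (x ∷ L) = cong (suc x ∷_) (begin
  filterᵇ (λ y → not (suc x ≡ᵇ y)) (dedup (map suc L))  ≡⟨ cong (filterᵇ (λ y → not (suc x ≡ᵇ y))) (dedup-map-suc L) ⟩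
  filterᵇ (λ y → not (suc x ≡ᵇ y)) (map suc (dedup L))  ≡⟨ filterᵇ-map (λ y → not (suc x ≡ᵇ y)) suc (dedup L) ⟩
  map suc (filterᵇ (λ y → not (x ≡ᵇ y)) (dedup L))      ∎)

reduce-map-suc : ∀ s → reduce (map suc s) ≡ reduce s
reduce-map-suc s = trans (sym (map-∘ s)) (map-cong rank s)
  where
  rank : ∀ b → length (dedup (filterᵇ (_<ᵇ suc b) (map suc s))) ≡ length (dedup (filterᵇ (_<ᵇ b) s))
  rank b = begin
    length (dedup (filterᵇ (_<ᵇ suc b) (map suc s)))  ≡⟨ cong (length ∘ dedup) (filterᵇ-map (_<ᵇ suc b) suc s) ⟩
    length (dedup (map suc (filterᵇ (_<ᵇ b) s)))      ≡⟨ cong length (dedup-map-suc (filterᵇ (_<ᵇ b) s)) ⟩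
    length (map suc (dedup (filterᵇ (_<ᵇ b) s)))      ≡⟨ length-map suc (dedup (filterᵇ (_<ᵇ b) s)) ⟩
    length (dedup (filterᵇ (_<ᵇ b) s))                ∎

reduce-∷ʳ0 : ∀ s → ∃ λ ys → reduce (s ∷ʳ 0) ≡ ys ∷ʳ 0
reduce-∷ʳ0 s = map rank s , (begin
  map rank (s ∷ʳ 0)                  ≡⟨ map-++ rank s (0 ∷ []) ⟩
  map rank s ++ rank 0 ∷ []          ≡⟨ cong (λ L → map rank s ++ length (dedup L) ∷ []) (no-entry-below-0 (s ∷ʳ 0)) ⟩
  map rank s ∷ʳ 0                    ∎)
  where
  rank : ℕ → ℕ
  rank a = length (dedup (filterᵇ (_<ᵇ a) (s ∷ʳ 0)))
  no-entry-below-0 : ∀ L → filterᵇ (_<ᵇ 0) L ≡ []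
  no-entry-below-0 []      = refl
  no-entry-below-0 (x ∷ L) = no-entry-below-0 L

eqList-sound : ∀ {xs ys} → eqList xs ys ≡ true → xs ≡ ys
eqList-sound {[]}     {[]}     _  = refl
eqList-sound {x ∷ xs} {y ∷ ys} eq with x ≡ᵇ y in x≡ᵇy
... | true  = cong₂ _∷_ (≡ᵇ-true⇒≡ x≡ᵇy) (eqList-sound eq)

matches : List ℕ → Bool
matches s = eqList (reduce s) p0012

matches-∷ʳ0 : ∀ s → matches (s ∷ʳ 0) ≡ false
matches-∷ʳ0 s with matches (s ∷ʳ 0) in eq
... | false = refl
... | true with reduce-∷ʳ0 s
...   | ys , reduced = ⊥-elim (0≢2 (∷ʳ-injectiveʳ ys (0 ∷ 0 ∷ 1 ∷ []) (trans (sym reduced) (eqList-sound eq))))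
  where
  0≢2 : 0 ≢ 2
  0≢2 ()

matches-0∷map-suc : ∀ s → matches (0 ∷ map suc s) ≡ false
matches-0∷map-suc []      = refl
matches-0∷map-suc (b ∷ s) = ∧-zeroʳ _

avoids-∷ʳ0 : ∀ e → avoids p0012 (e ∷ʳ 0) ≡ avoids p0012 e
avoids-∷ʳ0 e = cong not (begin
  any matches (subseqs (e ∷ʳ 0))
    ≡⟨ any-subseqs-∷ʳ matches e 0 ⟩
  any matches (subseqs e) ∨ any (matches ∘ (_∷ʳ 0)) (subseqs e)
    ≡⟨ cong (any matches (subseqs e) ∨_) (any-false (subseqs e) matches-∷ʳ0) ⟩
  any matches (subseqs e) ∨ false
    ≡⟨ ∨-identityʳ _ ⟩
  any matches (subseqs e) ∎)

avoids-0∷map-suc : ∀ r → avoids p0012 (0 ∷ map suc r) ≡ avoids p0012 r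
avoids-0∷map-suc r = cong not (begin
  any matches (subseqs (0 ∷ map suc r))
    ≡⟨ any-subseqs-∷ matches 0 (map suc r) ⟩
  any matches (subseqs (map suc r)) ∨ any (matches ∘ (0 ∷_)) (subseqs (map suc r))
    ≡⟨ cong₂ (λ S T → any matches S ∨ any (matches ∘ (0 ∷_)) T) (subseqs-map suc r) (subseqs-map suc r) ⟩
  any matches (map (map suc) S) ∨ any (matches ∘ (0 ∷_)) (map (map suc) S)
    ≡⟨ cong₂ _∨_ (any-map matches (map suc) S) (any-map (matches ∘ (0 ∷_)) (map suc) S) ⟩
  any (matches ∘ map suc) S ∨ any (matches ∘ (0 ∷_) ∘ map suc) S
    ≡⟨ cong₂ _∨_ (any-cong S (cong (λ t → eqList t p0012) ∘ reduce-map-suc)) (any-false S matches-0∷map-suc) ⟩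
  any matches S ∨ false
    ≡⟨ ∨-identityʳ _ ⟩
  any matches S ∎)
  where
  S : List (List ℕ)
  S = subseqs r

-- The counting identities

avoiders : ℕ → ℕ
avoiders n = length (filterᵇ (avoids p0012) (invSeqs n))

counted : ℕ → ℕ → List ℕ → Bool
counted k ℓ e = avoids p0012 e ∧ (srpt e ≡ᵇ k) ∧ (lastE e ≡ᵇ ℓ)

f-sumExt : ∀ n k ℓ → f n k ℓ ≡ sumExt (indicator ∘ counted k ℓ) 0 [] n
f-sumExt n k ℓ = count-invSeqs n (counted k ℓ)

avoiders-sumExt : ∀ n → avoiders n ≡ sumExt (indicator ∘ avoids p0012) 0 [] n
avoiders-sumExt n = count-invSeqs n (avoids p0012)

counted-srpt≢ : ∀ {k ℓ} e → srpt e ≢ k → counted k ℓ e ≡ false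
counted-srpt≢ e srpt≢k rewrite ≢⇒≡ᵇ-false srpt≢k = ∧-zeroʳ (avoids p0012 e)

counted-lastE≢ : ∀ {k ℓ} e → lastE e ≢ ℓ → counted k ℓ e ≡ false
counted-lastE≢ {k} e last≢ℓ rewrite ≢⇒≡ᵇ-false last≢ℓ | ∧-zeroʳ (srpt e ≡ᵇ k) = ∧-zeroʳ (avoids p0012 e)

counted-at-srpt-lastE : ∀ e → counted (srpt e) (lastE e) e ≡ avoids p0012 e
counted-at-srpt-lastE e rewrite ≡ᵇ-refl (srpt e) | ≡ᵇ-refl (lastE e) = ∧-identityʳ (avoids p0012 e)

counted-0∷map-suc : ∀ k ℓ x r → counted (suc k) (suc ℓ) (0 ∷ map suc (x ∷ r)) ≡ counted k ℓ (x ∷ r)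
counted-0∷map-suc k ℓ x r rewrite avoids-0∷map-suc (x ∷ r) | srpt-0∷map-suc x r | lastE-map-suc x r = refl

f-shift : ∀ {n} k ℓ → 1 ≤ n → f (suc n) (suc k) (suc ℓ) ≡ f n k ℓ
f-shift {n} k ℓ 1≤n = begin
  f (suc n) (suc k) (suc ℓ)                       ≡⟨ f-sumExt (suc n) (suc k) (suc ℓ) ⟩
  sumExt h 0 [] (suc n)                           ≡⟨ sumExt-head n h ⟩
  sumExt (h ∘ (0 ∷_)) 1 [] n                      ≡⟨ sumExt-map-suc n (h ∘ (0 ∷_)) repeated-0 0 [] ⟩
  sumExt (h ∘ (0 ∷_) ∘ map suc) 0 [] n            ≡⟨ sumExt-congInv n 0 [] [] refl shifted ⟩
  sumExt (indicator ∘ counted k ℓ) 0 [] n         ≡⟨ f-sumExt n k ℓ ⟨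
  f n k ℓ                                         ∎
  where
  h : List ℕ → ℕ
  h = indicator ∘ counted (suc k) (suc ℓ)
  repeated-0 : ∀ q → 0 ∈ q → h (0 ∷ q) ≡ 0
  repeated-0 q 0∈q = cong indicator (counted-srpt≢ (0 ∷ q) (λ eq → 0≢1+n (trans (sym (srpt-0∷ q 0∈q)) eq)))
  shifted : ∀ e → InvSeq e → length e ≡ n → h (0 ∷ map suc e) ≡ indicator (counted k ℓ e)
  shifted []      _ len = ⊥-elim (<⇒≢ 1≤n len)
  shifted (x ∷ r) _ _   = cong indicator (counted-0∷map-suc k ℓ x r)

f-diagonal : ∀ i {m} → 1 ≤ m → f (i + m) i i ≡ f m 0 0
f-diagonal zero    1≤m = refl
f-diagonal (suc i) {m} 1≤m = trans (f-shift i i (≤-trans 1≤m (m≤n+m m i))) (f-diagonal i 1≤m)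

f-zero-zero : ∀ m → f (suc (suc m)) 0 0 ≡ avoiders (suc m)
f-zero-zero m = begin
  f (suc (suc m)) 0 0                                          ≡⟨ f-sumExt (suc (suc m)) 0 0 ⟩
  sumExt h 0 [] (suc (suc m))                                  ≡⟨ sumExt-head (suc m) h ⟩
  sumExt (h ∘ (0 ∷_)) 1 [] (suc m)                             ≡⟨ sumExt-∷ʳ m (h ∘ (0 ∷_)) 1 [] ⟩
  sumExt (λ q → sumTo (suc m) (λ v → h (0 ∷ (q ∷ʳ v)))) 1 [] m ≡⟨ sumExt-cong m last-is-0 1 [] ⟩
  sumExt (indicator ∘ avoids p0012 ∘ (0 ∷_)) 1 [] m            ≡⟨ sumExt-head m (indicator ∘ avoids p0012) ⟨
  sumExt (indicator ∘ avoids p0012) 0 [] (suc m)               ≡⟨ avoiders-sumExt (suc m) ⟨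
  avoiders (suc m)                                             ∎
  where
  h : List ℕ → ℕ
  h = indicator ∘ counted 0 0
  -- The leading 0 and the final 0 make srpt = 0 automatic.
  last-is-0 : ∀ q → sumTo (suc m) (λ v → h (0 ∷ (q ∷ʳ v))) ≡ indicator (avoids p0012 (0 ∷ q))
  last-is-0 q = begin
    sumTo (suc m) (λ v → h (0 ∷ (q ∷ʳ v)))
      ≡⟨ sumTo-single (suc m) 0 z≤n (λ v _ v≢0 → cong indicator (counted-lastE≢ (e v) (v≢0 ∘ trans (sym (last v))))) ⟩
    indicator (counted 0 0 (e 0))
      ≡⟨ cong₂ (λ k ℓ → indicator (counted k ℓ (e 0))) srpt≡0 (last 0) ⟨
    indicator (counted (srpt (e 0)) (lastE (e 0)) (e 0))
      ≡⟨ cong indicator (counted-at-srpt-lastE (e 0)) ⟩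
    indicator (avoids p0012 ((0 ∷ q) ∷ʳ 0))
      ≡⟨ cong indicator (avoids-∷ʳ0 (0 ∷ q)) ⟩
    indicator (avoids p0012 (0 ∷ q)) ∎
    where
    e : ℕ → List ℕ
    e v = 0 ∷ (q ∷ʳ v)
    last : ∀ v → lastE (e v) ≡ v
    last = lastE-∷ʳ (0 ∷ q)
    srpt≡0 : srpt (e 0) ≡ 0
    srpt≡0 = srpt-0∷ (q ∷ʳ 0) (∈-++⁺ʳ q (here refl))

-- Each avoider e is counted exactly once, at k = srpt e ≤ ℓ = last e.
F11coef-avoiders : ∀ m → F11coef (suc m) ≡ avoiders (suc m)
F11coef-avoiders m = begin
  sumTo m (λ ℓ → sumTo ℓ (λ k → f (suc m) k ℓ))
    ≡⟨ sumTo-cong m (λ ℓ _ → sumTo-cong ℓ (λ k _ → f-sumExt (suc m) k ℓ)) ⟩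
  sumTo m (λ ℓ → sumTo ℓ (λ k → sumExt (G ℓ k) 0 [] (suc m)))
    ≡⟨ sumTo-cong m (λ ℓ _ → sumExt-sumTo (suc m) ℓ (G ℓ) 0 []) ⟨
  sumTo m (λ ℓ → sumExt (λ e → sumTo ℓ (λ k → G ℓ k e)) 0 [] (suc m))
    ≡⟨ sumExt-sumTo (suc m) m (λ ℓ e → sumTo ℓ (λ k → G ℓ k e)) 0 [] ⟨
  sumExt (λ e → sumTo m (λ ℓ → sumTo ℓ (λ k → G ℓ k e))) 0 [] (suc m)
    ≡⟨ sumExt-congInv (suc m) 0 [] [] refl counted-once ⟩
  sumExt (indicator ∘ avoids p0012) 0 [] (suc m)
    ≡⟨ avoiders-sumExt (suc m) ⟨
  avoiders (suc m) ∎
  where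
  G : ℕ → ℕ → List ℕ → ℕ
  G ℓ k = indicator ∘ counted k ℓ
  counted-once : ∀ e → InvSeq e → length e ≡ suc m →
                 sumTo m (λ ℓ → sumTo ℓ (λ k → G ℓ k e)) ≡ indicator (avoids p0012 e)
  counted-once .(p ∷ʳ v) (snoc {p} {v} inv v≤len) len = begin
    sumTo m (λ ℓ → sumTo ℓ (λ k → G ℓ k e))
      ≡⟨ sumTo-single m (lastE e) last≤m (λ ℓ _ ℓ≢last →
           sumTo-zero ℓ (λ k _ → cong indicator (counted-lastE≢ e (ℓ≢last ∘ sym)))) ⟩
    sumTo (lastE e) (λ k → G (lastE e) k e)
      ≡⟨ sumTo-single (lastE e) (srpt e) srpt≤last (λ k _ k≢srpt →
           cong indicator (counted-srpt≢ e (k≢srpt ∘ sym))) ⟩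
    G (lastE e) (srpt e) e
      ≡⟨ cong indicator (counted-at-srpt-lastE e) ⟩
    indicator (avoids p0012 e) ∎
    where
    e : List ℕ
    e = p ∷ʳ v
    last≤m : lastE e ≤ m
    last≤m = subst₂ _≤_ (sym (lastE-∷ʳ p v)) (suc-injective (trans (sym (length-∷ʳ p v)) len)) v≤len
    srpt≤last : srpt e ≤ lastE e
    srpt≤last = subst (srpt e ≤_) (sym (lastE-∷ʳ p v)) (srpt-∷ʳ-≤ inv v≤len)

D-≤ : ∀ {n ℓ} → ℓ + 2 ≤ n → D n ℓ ≡ f n ℓ ℓ
D-≤ {n} {ℓ} ℓ+2≤n
  rewrite dec-true (1 ≤? n) (≤-trans (s≤s z≤n) (≤-trans (m≤n+m 2 ℓ) ℓ+2≤n)) | dec-true (ℓ + 2 ≤? n) ℓ+2≤n = refl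

D-≰ : ∀ {n ℓ} → ¬ ℓ + 2 ≤ n → D n ℓ ≡ 0
D-≰ {n} {ℓ} ℓ+2≰n rewrite dec-false (ℓ + 2 ≤? n) ℓ+2≰n | ∧-zeroʳ (1 ≤ᵇ n) = refl

D-shift : ∀ i m → D (i + m) i ≡ D m 0
D-shift i m with 2 ≤? m
... | yes 2≤m = begin
  D (i + m) i    ≡⟨ D-≤ (+-monoʳ-≤ i 2≤m) ⟩
  f (i + m) i i  ≡⟨ f-diagonal i (≤-trans (s≤s z≤n) 2≤m) ⟩
  f m 0 0        ≡⟨ D-≤ 2≤m ⟨
  D m 0          ∎
... | no  2≰m = trans (D-≰ (2≰m ∘ +-cancelˡ-≤ i 2 m)) (sym (D-≰ 2≰m))

D-zero : ∀ m → D m 0 ≡ F11coef (pred m)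
D-zero zero          = refl
D-zero (suc zero)    = refl
D-zero (suc (suc m)) = trans (f-zero-zero m) (sym (F11coef-avoiders m))

qSer-⊛-geomXQ-⊛-F11 : ∀ i m → ((qSer ⊛ geomXQ) ⊛ F11) (i + m) i ≡ F11coef (pred m)
qSer-⊛-geomXQ-⊛-F11 i zero    = trans (⊛-congˡ F11 qSer-⊛-geomXQ (i + 0) i)
  (geomShift-⊛-> F11-constantInX 1 (s≤s (≤-reflexive (+-identityʳ i))))
qSer-⊛-geomXQ-⊛-F11 i (suc m) = begin
  ((qSer ⊛ geomXQ) ⊛ F11) (i + suc m) i
    ≡⟨ ⊛-congˡ F11 qSer-⊛-geomXQ (i + suc m) i ⟩
  (geomShift 1 ⊛ F11) (i + suc m) i
    ≡⟨ geomShift-⊛ F11-constantInX 1 (≤-trans (s≤s (m≤m+n i m)) (≤-reflexive (sym (+-suc i m)))) ⟩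
  F11coef (i + suc m ∸ suc i)
    ≡⟨ cong F11coef (trans (cong (_∸ suc i) (+-suc i m)) (m+n∸m≡n i m)) ⟩
  F11coef m ∎

lemma5p1 : (n i : ℕ) →
    (D n i ≡ (geomXQ ⊛ D0) n i) × ((geomXQ ⊛ D0) n i ≡ ((qSer ⊛ geomXQ) ⊛ F11) n i)
lemma5p1 n i with i ≤? n
... | no i≰n = trans (D-≰ (i≰n ∘ ≤-trans (m≤m+n i 2))) (sym geom-vanishes) , trans geom-vanishes (sym q-geom-vanishes)
  where
  n<i : n < i
  n<i = ≰⇒> i≰n
  geom-vanishes : (geomXQ ⊛ D0) n i ≡ 0
  geom-vanishes = geomShift-⊛-> D0-constantInX 0 n<i
  q-geom-vanishes : ((qSer ⊛ geomXQ) ⊛ F11) n i ≡ 0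
  q-geom-vanishes = trans (⊛-congˡ F11 qSer-⊛-geomXQ n i) (geomShift-⊛-> F11-constantInX 1 (m≤n⇒m≤1+n n<i))
... | yes i≤n with m≤n⇒∃[o]m+o≡n i≤n
...   | m , refl = trans (D-shift i m) (sym geom) , trans geom (trans (D-zero m) (sym (qSer-⊛-geomXQ-⊛-F11 i m)))
  where
  geom : (geomXQ ⊛ D0) (i + m) i ≡ D m 0
  geom = trans (geomShift-⊛ D0-constantInX 0 i≤n) (cong (λ j → D j 0) (m+n∸m≡n i m))
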